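{- For every real $\delta\in(0,1)$ and all integers $m\ge k\ge 0$ there exists a positive integer $M=F(\delta,k,m)$ with the following property. Suppose $A_1,\dots,A_M$ are finite nonempty sets and for all $1\le i<j\le M$ subsets $X_{ij}\subseteq A_i$ with $|X_{ij}|\ge\delta|A_i|$ are given. Then there are indices $1\le n_1<\dots<n_m\le M$ and elements $a_1\in A_{n_1},\dots,a_k\in A_{n_k}$ such that $a_i\in\bigcap_{j\in(i,m]}X_{n_in_j}$ holds for all $i\in[k]$.
   Formalization: The parameter δ ranges over the rationals in $(0,1)$ rather than over all reals in $(0,1)$. -}

module Defs where

open import Data.Nat using (ℕ)
open import Data.Integer using (+_)
open import Data.Rational using (ℚ; _/_)

ℕ→ℚ : ℕ → ℚ
ℕ→ℚ n = + n / 1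

-- Writing δ = a/d with a ≥ 1, the hypothesis δ|A_i| ≤ |X_ij| gives |A_i| ≤ d|X_ij|, so only the
-- integer q = d matters. Put F(q,0,m) = m+1 and F(q,k+1,m+1) = 1 + q F(q,k,m), and N = F(q,k,m).
-- The q N sets X_1j (j > 1) have total size at least N|A_1|, so by double counting some a_1 ∈ A_1
-- lies in N of them; take n_1 = 1 and recurse among those N indices.
module Submission where

module Counting where
  import Algebra.Properties.Semiring.Sum
  open import Data.Nat using (ℕ; zero; suc; _*_; _≤_; _<_; z≤n; s≤s; z<s; NonZero)
  open import Data.Nat.Properties
  open import Data.Fin as F using (Fin; zero; suc)
  open import Data.Fin.Properties using (any?)
  open import Data.Fin.Subset using (Subset; Side; inside; outside; _∈_; ∣_∣)
  open import Data.Vec using ([]; _∷_; lookup; tabulate; here; there)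
  open import Data.Vec.Properties using (lookup⇒[]=; []=⇒lookup; lookup∘tabulate)
  open import Data.Product using (Σ; ∃; _×_; _,_)
  open import Function using (_∘_)
  open import Relation.Binary.Core using (_Preserves_⟶_)
  open import Relation.Binary.PropositionalEquality
  open import Relation.Nullary using (yes; no; contradiction)

  open Algebra.Properties.Semiring.Sum +-*-semiring using (sum; ∑-comm; *-distribˡ-sum; sum-cong-≗)

  n*c≤sum : ∀ {n} c (f : Fin n → ℕ) → (∀ i → c ≤ f i) → n * c ≤ sum f
  n*c≤sum {zero}  c f c≤f = z≤n
  n*c≤sum {suc n} c f c≤f = +-mono-≤ (c≤f zero) (n*c≤sum c (f ∘ suc) (c≤f ∘ suc))

  sum<n*c : ∀ {n} .{{_ : NonZero n}} c (f : Fin n → ℕ) → (∀ i → f i < c) → sum f < n * c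
  sum<n*c {suc zero}    c f f<c = +-monoˡ-< 0 (f<c zero)
  sum<n*c {suc (suc n)} c f f<c = +-mono-< (f<c zero) (sum<n*c c (f ∘ suc) (f<c ∘ suc))

  n*c≤sum⇒∃c≤f : ∀ {n} .{{_ : NonZero n}} c (f : Fin n → ℕ) → n * c ≤ sum f → ∃ λ i → c ≤ f i
  n*c≤sum⇒∃c≤f c f n*c≤∑f with any? (λ i → c ≤? f i)
  ... | yes c≤fᵢ  = c≤fᵢ
  ... | no  ∄c≤fᵢ = contradiction n*c≤∑f
                      (<⇒≱ (sum<n*c c f (λ i → ≰⇒> (λ c≤fᵢ → ∄c≤fᵢ (i , c≤fᵢ)))))

  𝟙 : Side → ℕ
  𝟙 inside  = 1
  𝟙 outside = 0

  ∣p∣≡∑𝟙 : ∀ {n} (p : Subset n) → ∣ p ∣ ≡ sum (𝟙 ∘ lookup p)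
  ∣p∣≡∑𝟙 []            = refl
  ∣p∣≡∑𝟙 (inside  ∷ p) = cong suc (∣p∣≡∑𝟙 p)
  ∣p∣≡∑𝟙 (outside ∷ p) = ∣p∣≡∑𝟙 p

  transpose : ∀ {m n} → (Fin m → Subset n) → Fin n → Subset m
  transpose Y a = tabulate λ j → lookup (Y j) a

  ∈-transpose⁻ : ∀ {m n} (Y : Fin m → Subset n) {a j} → j ∈ transpose Y a → a ∈ Y j
  ∈-transpose⁻ Y {a} {j} j∈Yᵀa =
    lookup⇒[]= a (Y j) (trans (sym (lookup∘tabulate (λ j → lookup (Y j) a) j)) ([]=⇒lookup j∈Yᵀa))

  sum-∣transpose∣ : ∀ {m n} (Y : Fin m → Subset n) → sum (∣_∣ ∘ transpose Y) ≡ sum (∣_∣ ∘ Y)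
  sum-∣transpose∣ {m} {n} Y = begin
    sum (λ a → ∣ transpose Y a ∣)                ≡⟨ sum-cong-≗ {n} (λ a → ∣p∣≡∑𝟙 (transpose Y a)) ⟩
    sum (λ a → sum (𝟙 ∘ lookup (transpose Y a))) ≡⟨ sum-cong-≗ {n} (λ a → sum-cong-≗ {m} (λ j → cong 𝟙 (lookup∘tabulate _ j))) ⟩
    sum (λ a → sum (λ j → 𝟙 (lookup (Y j) a)))   ≡⟨ ∑-comm (λ a j → 𝟙 (lookup (Y j) a)) ⟩
    sum (λ j → sum (𝟙 ∘ lookup (Y j)))           ≡⟨ sum-cong-≗ {m} (λ j → sym (∣p∣≡∑𝟙 (Y j))) ⟩
    sum (λ j → ∣ Y j ∣)                          ∎
    where open ≡-Reasoning

  Increasing : ∀ {m n} → (Fin m → Fin n) → Set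
  Increasing e = e Preserves F._<_ ⟶ F._<_

  enumerate : ∀ {n} N (p : Subset n) → N ≤ ∣ p ∣ →
              Σ (Fin N → Fin n) λ e → Increasing e × (∀ j → e j ∈ p)
  enumerate zero    p             _           = (λ ()) , (λ { {()} }) , (λ ())
  enumerate (suc N) (inside ∷ p)  (s≤s N≤∣p∣) with enumerate N p N≤∣p∣
  ... | e , e-inc , e∈p = e′ , e′-inc , e′∈p
    where
    e′ : Fin (suc N) → Fin _
    e′ zero    = zero
    e′ (suc j) = suc (e j)
    e′-inc : Increasing e′
    e′-inc {zero}  {suc j} _         = z<s
    e′-inc {suc i} {suc j} (s≤s i<j) = s≤s (e-inc i<j)
    e′∈p : ∀ j → e′ j ∈ inside ∷ p
    e′∈p zero    = here
    e′∈p (suc j) = there (e∈p j)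
  enumerate (suc N) (outside ∷ p) N≤∣p∣ with enumerate (suc N) p N≤∣p∣
  ... | e , e-inc , e∈p = suc ∘ e , s≤s ∘ e-inc , there ∘ e∈p

  common-point : ∀ {m n} .{{_ : NonZero n}} N (Y : Fin m → Subset n) → n * N ≤ sum (∣_∣ ∘ Y) →
                 ∃ λ a → Σ (Fin N → Fin m) λ e → Increasing e × (∀ j → a ∈ Y (e j))
  common-point N Y n*N≤∑∣Y∣ with n*c≤sum⇒∃c≤f N (∣_∣ ∘ transpose Y) (subst (_ ≤_) (sym (sum-∣transpose∣ Y)) n*N≤∑∣Y∣)
  ... | a , N≤∣Yᵀa∣ with enumerate N (transpose Y a) N≤∣Yᵀa∣
  ... | e , e-inc , e∈Yᵀa = a , e , e-inc , ∈-transpose⁻ Y ∘ e∈Yᵀa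

  n*N≤sum : ∀ q .{{_ : NonZero q}} N {n} (Y : Fin (q * N) → Subset n) →
            (∀ j → n ≤ q * ∣ Y j ∣) → n * N ≤ sum (∣_∣ ∘ Y)
  n*N≤sum q N {n} Y n≤q*∣Y∣ = *-cancelˡ-≤ q (begin
    q * (n * N)             ≡⟨ cong (q *_) (*-comm n N) ⟩
    q * (N * n)             ≡⟨ *-assoc q N n ⟨
    (q * N) * n             ≤⟨ n*c≤sum n (λ j → q * ∣ Y j ∣) n≤q*∣Y∣ ⟩
    sum (λ j → q * ∣ Y j ∣) ≡⟨ *-distribˡ-sum q (∣_∣ ∘ Y) ⟨
    q * sum (∣_∣ ∘ Y)       ∎)
    where open ≤-Reasoning

module Rationals where
  open import Defs
  open import Data.Nat as ℕ using (suc)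
  import Data.Nat.Properties as ℕ
  open import Data.Integer as ℤ using (+_; -[1+_]; +<+)
  import Data.Integer.Properties as ℤ
  open import Data.Rational using (ℚ; mkℚ; 0ℚ; _*_; _≤_; _<_; *<*; toℚᵘ; ↧ₙ_)
  import Data.Rational.Properties as ℚ
  open import Data.Rational.Unnormalised as ℚᵘ using (mkℚᵘ; *≤*)
  import Data.Rational.Unnormalised.Properties as ℚᵘ
  open import Relation.Binary.PropositionalEquality

  toℚᵘ-ℕ→ℚ : ∀ n → toℚᵘ (ℕ→ℚ n) ℚᵘ.≃ mkℚᵘ (+ n) 0
  toℚᵘ-ℕ→ℚ n = ℚ.toℚᵘ-fromℚᵘ (mkℚᵘ (+ n) 0)

  toℚᵘ-mono-*ℕ→ℚ : ∀ δ m n → δ * ℕ→ℚ m ≤ ℕ→ℚ n → toℚᵘ δ ℚᵘ.* mkℚᵘ (+ m) 0 ℚᵘ.≤ mkℚᵘ (+ n) 0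
  toℚᵘ-mono-*ℕ→ℚ δ m n δm≤n =
    ℚᵘ.≤-respʳ-≃ (toℚᵘ-ℕ→ℚ n)
      (ℚᵘ.≤-respˡ-≃ (ℚᵘ.≃-trans (ℚ.toℚᵘ-homo-* δ (ℕ→ℚ m)) (ℚᵘ.*-congˡ {toℚᵘ δ} (toℚᵘ-ℕ→ℚ m)))
        (ℚ.toℚᵘ-mono-≤ δm≤n))

  ≤↧ₙ* : ∀ δ m n → 0ℚ < δ → δ * ℕ→ℚ m ≤ ℕ→ℚ n → m ℕ.≤ ↧ₙ δ ℕ.* n
  ≤↧ₙ* (mkℚ (+ 0) _ _)    m n (*<* (+<+ ())) _
  ≤↧ₙ* (mkℚ -[1+ _ ] _ _) m n (*<* ())       _
  ≤↧ₙ* δ@(mkℚ (+ suc a) d _) m n _ δm≤n with toℚᵘ-mono-*ℕ→ℚ δ m n δm≤n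
  ... | *≤* am≤nd = begin
    m               ≤⟨ ℕ.m≤m+n m (a ℕ.* m) ⟩
    suc a ℕ.* m     ≤⟨ ℤ.drop‿+≤+ (subst₂ ℤ._≤_ lhs rhs am≤nd) ⟩
    n ℕ.* suc d     ≡⟨ ℕ.*-comm n (suc d) ⟩
    suc d ℕ.* n     ∎
    where
    open ℕ.≤-Reasoning
    lhs : (+ suc a ℤ.* + m) ℤ.* + 1 ≡ + (suc a ℕ.* m)
    lhs = trans (ℤ.*-identityʳ _) (sym (ℤ.pos-* (suc a) m))
    rhs : + n ℤ.* + (suc d ℕ.* 1) ≡ + (n ℕ.* suc d)
    rhs = trans (sym (ℤ.pos-* n _)) (cong (λ t → + (n ℕ.* t)) (ℕ.*-identityʳ (suc d)))

module Selections where
  open import Data.Nat using (ℕ; zero; suc; _*_; _≤_; _<_; _≥_; _>_; z≤n; s≤s; z<s; NonZero; >-nonZero)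
  open import Data.Fin as F using (Fin; zero; suc; toℕ)
  open import Data.Fin.Subset using (Subset; _∈_; ∣_∣)
  open import Data.Product using (Σ; _,_)
  open import Function using (_∘_)
  open Counting using (Increasing; common-point; n*N≤sum)

  PairSubsets : (M : ℕ) → (Fin M → ℕ) → Set
  PairSubsets M s = (i j : Fin M) → i F.< j → Subset (s i)

  Selection : ∀ {M} (s : Fin M → ℕ) → PairSubsets M s → (k m : ℕ) → Set
  Selection {M} s X k m =
    Σ (Fin m → Fin M) λ n →
      Σ (Increasing n) λ n-inc →
        Σ ((i : Fin m) → toℕ i < k → Fin (s (n i))) λ a →
          ∀ (i j : Fin m) (i<j : i F.< j) (i<k : toℕ i < k) → a i i<k ∈ X (n i) (n j) (n-inc i<j)

  bound : ℕ → ∀ {k m} → k ≤ m → ℕ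
  bound q {m = m} z≤n     = suc m
  bound q         (s≤s k≤m) = suc (q * bound q k≤m)

  bound>0 : ∀ q {k m} (k≤m : k ≤ m) → bound q k≤m > 0
  bound>0 q z≤n     = z<s
  bound>0 q (s≤s _) = z<s

  selection : ∀ q .{{_ : NonZero q}} {k m} (k≤m : k ≤ m) (s : Fin (bound q k≤m) → ℕ) → (∀ i → s i ≥ 1) →
              (X : PairSubsets (bound q k≤m) s) → (∀ i j i<j → s i ≤ q * ∣ X i j i<j ∣) →
              Selection s X k m
  selection q z≤n s _ X _ = suc , s≤s , (λ _ ()) , (λ _ _ _ ())
  selection q {suc k} {suc m} (s≤s k≤m) s s≥1 X dense
    with common-point {{>-nonZero (s≥1 zero)}} _ X₀ (n*N≤sum q (bound q k≤m) X₀ (λ j → dense zero (suc j) z<s))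
    where
    X₀ : Fin (q * bound q k≤m) → Subset (s zero)
    X₀ j = X zero (suc j) z<s
  ... | a₀ , e , e-inc , a₀∈X₀ₑ
    with selection q k≤m (s ∘ suc ∘ e) (s≥1 ∘ suc ∘ e)
           (λ i j i<j → X (suc (e i)) (suc (e j)) (s≤s (e-inc i<j)))
           (λ i j i<j → dense (suc (e i)) (suc (e j)) (s≤s (e-inc i<j)))
  ... | n , n-inc , a , a∈X = n′ , n′-inc , a′ , a′∈X
    where
    n′ : Fin (suc m) → Fin (bound q (s≤s k≤m))
    n′ zero    = zero
    n′ (suc i) = suc (e (n i))
    n′-inc : Increasing n′
    n′-inc {zero}  {suc j} _         = z<s
    n′-inc {suc i} {suc j} (s≤s i<j) = s≤s (e-inc (n-inc i<j))
    a′ : (i : Fin (suc m)) → toℕ i < suc k → Fin (s (n′ i))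
    a′ zero    _         = a₀
    a′ (suc i) (s≤s i<k) = a i i<k
    a′∈X : ∀ i j (i<j : i F.< j) (i<k : toℕ i < suc k) → a′ i i<k ∈ X (n′ i) (n′ j) (n′-inc i<j)
    a′∈X zero    (suc j) _         _         = a₀∈X₀ₑ (n j)
    a′∈X (suc i) (suc j) (s≤s i<j) (s≤s i<k) = a∈X i j i<j i<k

open import Defs
open import Data.Nat using (ℕ; _≤_; _≥_; _>_)
open import Data.Fin using (Fin; toℕ)
open import Data.Fin.Subset using (Subset; _∈_; ∣_∣)
open import Data.Rational using (ℚ; 0ℚ; 1ℚ; _*_; ↧ₙ_) renaming (_<_ to _<ℚ_; _≤_ to _≤ℚ_)
open import Data.Product using (Σ; ∃; _×_; _,_)
import Data.Fin as F
open Rationals using (≤↧ₙ*)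
open Selections using (bound; bound>0; selection)

lemma7p1 : (δ : ℚ) → 0ℚ <ℚ δ → δ <ℚ 1ℚ → (k m : ℕ) → k ≤ m →
    ∃ λ (M : ℕ) → M > 0 ×
      ((s : Fin M → ℕ) → (∀ i → s i ≥ 1) →
       (X : (i j : Fin M) → i F.< j → Subset (s i)) →
       (∀ i j (i<j : i F.< j) → δ * ℕ→ℚ (s i) ≤ℚ ℕ→ℚ ∣ X i j i<j ∣) →
       Σ (Fin m → Fin M) λ n →
         Σ (∀ {i j} → i F.< j → n i F.< n j) λ mono →
           Σ ((i : Fin m) → toℕ i Data.Nat.< k → Fin (s (n i))) λ a →
             ∀ (i j : Fin m) (i<j : i F.< j) (i<k : toℕ i Data.Nat.< k) →
               a i i<k ∈ X (n i) (n j) (mono i<j))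
lemma7p1 δ 0<δ _ k m k≤m =
  bound (↧ₙ δ) k≤m , bound>0 (↧ₙ δ) k≤m ,
  λ s s≥1 X δs≤∣X∣ → selection (↧ₙ δ) k≤m s s≥1 X (λ i j i<j → ≤↧ₙ* δ (s i) ∣ X i j i<j ∣ 0<δ (δs≤∣X∣ i j i<j))
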